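{- The pointed set species $\mathbf{C}$ of coloring problems, with restriction and contraction of coloring problems, is a combinatorial comonoid.
   Context: A coloring problem on a finite set $N$ is a pair $(\mathbf{p},I)$ where $\mathbf{p}$ is a family of subsets of $N$ with $\emptyset,N\in\mathbf{p}$, ordered by inclusion, and $I$ is an order ideal of the poset $\mathrm{Int}(\mathbf{p})$ of intervals $[S,T]$ ($S\subseteq T$ in $\mathbf{p}$, ordered by inclusion) containing $[S,S]$ for all $S\in\mathbf{p}$. $\mathbf{C}_N=\{0\}\sqcup\{\text{coloring problems on }N\}$ (base point $0$), with relabeling along bijections $\sigma$ given by $(\mathbf{p},I)\mapsto(\{\sigma(S)\},\{[\sigma(S),\sigma(T)]\})$. For $\mathbf{c}=(\mathbf{p},I)$ on $N$ and $S\subseteq N$: if $S\notin\mathbf{p}$ then $\mathbf{c}|_S=0$ and $\mathbf{c}/S=0$; if $S\in\mathbf{p}$ then $\mathbf{c}|_S=(\{T\in\mathbf{p}:T\subseteq S\},\{[X,Y]\in I:Y\subseteq S\})\in\mathbf{C}_S$ and $\mathbf{c}/S=(\{X\subseteq N\setminus S:X\cup S\in\mathbf{p}\},\{[X,Y]:X\subseteq Y\subseteq N\setminus S,[X\cup S,Y\cup S]\in I\})\in\mathbf{C}_{N\setminus S}$; also $0|_S=0/S=0$. A pointed set species $\mathbf{F}$ (functor from finite sets with bijections to pointed sets, base point $0$) is a comonoid if for each $N=S\sqcup T$ and $\mathbf{x}\in\mathbf{F}_N$ there are $\mathbf{x}|_S\in\mathbf{F}_S$, $\mathbf{x}/S\in\mathbf{F}_T$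 with: naturality ($\mathbf{F}_\sigma(\mathbf{x})|_{\sigma(S)}=\mathbf{F}_{\sigma|_S}(\mathbf{x}|_S)$, $\mathbf{F}_\sigma(\mathbf{x})/\sigma(S)=\mathbf{F}_{\sigma|_T}(\mathbf{x}/S)$); coassociativity (for $R\subseteq S$: $\mathbf{x}|_S/R=(\mathbf{x}/R)|_{S\setminus R}$, and if $\mathbf{x}|_S/R\neq0$ then $(\mathbf{x}|_S)|_R=\mathbf{x}|_R$ and $\mathbf{x}/S=(\mathbf{x}/R)/(S\setminus R)$); counitality ($\mathbf{x}|_N=\mathbf{x}=\mathbf{x}/\emptyset$); zero conditions ($\mathbf{x}|_S=0$ iff $\mathbf{x}/S=0$; $0|_S=0/S=0$). It is a combinatorial comonoid if moreover for all $S\subseteq T\subseteq N$ and $\mathbf{x}\in\mathbf{F}_N$ with $\mathbf{x}|_S\neq0$ and $\mathbf{x}|_T\neq0$, we have $\mathbf{x}|_T/S\neq0$. -}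

module Defs where

open import Data.Nat using (ℕ)
open import Data.Bool using (Bool; true; false; _∧_; T; not)
import Data.Bool as B
open import Data.Fin.Subset using (Subset; _⊆_; _∪_; _∩_; _─_)
import Data.Fin.Subset as Sub
open import Data.Fin.Subset.Properties using (_⊆?_)
open import Data.Fin.Permutation using (Permutation′; _⟨$⟩ˡ_; _∘ₚ_)
import Data.Fin.Permutation as P
open import Data.Vec using (tabulate; lookup)
open import Data.Vec.Properties using (≡-dec)
open import Data.Maybe using (Maybe; just; nothing)
open import Data.Product using (_×_)
open import Data.Unit using (⊤)
open import Data.Empty using () renaming (⊥ to Empty)
open import Relation.Nullary using (¬_)
open import Relation.Nullary.Decidable using (⌊_⌋)
open import Relation.Binary.PropositionalEquality using (_≡_)

-- All finite sets N are subsets of an ambient finite set  Fin m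
-- (m arbitrary).
-- Bijections between finite sets are (restrictions of) permutations of
-- Fin m ; the image of X under σ is  image σ X .

_==_ : ∀ {m} → Subset m → Subset m → Bool
X == Y = ⌊ ≡-dec B._≟_ X Y ⌋

_⊆ᵇ_ : ∀ {m} → Subset m → Subset m → Bool
X ⊆ᵇ Y = ⌊ X ⊆? Y ⌋

disjointᵇ : ∀ {m} → Subset m → Subset m → Bool
disjointᵇ X Y = (X ∩ Y) == Sub.⊥

image : ∀ {m} → Permutation′ m → Subset m → Subset m
image σ X = tabulate (λ j → lookup X (σ ⟨$⟩ˡ j))

-- Generic notion: a pointed set species (on finite subsets of Fin m),
-- encoded by a carrier  A  of raw elements, a predicate  Elem N x
-- ("x ∈ F_N"), an equality  _≈_  of elements, base point  0# ,
-- relabelling, restriction  x |[ S ]  and contraction  x /[ S ] .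

record SpeciesData (m : ℕ) : Set₁ where
  infix 4 _≈_
  infixl 6 _|[_] _/[_]
  field
    A        : Set
    Elem     : Subset m → A → Set
    _≈_      : A → A → Set
    0#       : A
    relabel  : Permutation′ m → A → A
    _|[_]    : A → Subset m → A
    _/[_]    : A → Subset m → A

record IsCombinatorialComonoid {m : ℕ} (F : SpeciesData m) : Set where
  open SpeciesData F
  field
    zero-elem     : ∀ N → Elem N 0#
    relabel-elem  : ∀ σ N x → Elem N x → Elem (image σ N) (relabel σ x)
    relabel-zero  : ∀ σ → relabel σ 0# ≈ 0#
    relabel-id    : ∀ N x → Elem N x → relabel P.id x ≈ x
    relabel-comp  : ∀ σ τ N x → Elem N x →
                    relabel (σ ∘ₚ τ) x ≈ relabel τ (relabel σ x)
    restrict-elem : ∀ N S x → Elem N x → S ⊆ N → Elem S (x |[ S ])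
    contract-elem : ∀ N S x → Elem N x → S ⊆ N → Elem (N ─ S) (x /[ S ])
    nat-restrict  : ∀ σ N S x → Elem N x → S ⊆ N →
                    (relabel σ x) |[ image σ S ] ≈ relabel σ (x |[ S ])
    nat-contract  : ∀ σ N S x → Elem N x → S ⊆ N →
                    (relabel σ x) /[ image σ S ] ≈ relabel σ (x /[ S ])
    coassoc₁      : ∀ N S R x → Elem N x → R ⊆ S → S ⊆ N →
                    (x |[ S ]) /[ R ] ≈ (x /[ R ]) |[ S ─ R ]
    coassoc₂      : ∀ N S R x → Elem N x → R ⊆ S → S ⊆ N →
                    ¬ ((x |[ S ]) /[ R ] ≈ 0#) →
                    ((x |[ S ]) |[ R ] ≈ x |[ R ])
                    × (x /[ S ] ≈ (x /[ R ]) /[ S ─ R ])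
    counit-restrict : ∀ N x → Elem N x → x |[ N ] ≈ x
    counit-contract : ∀ N x → Elem N x → x /[ Sub.⊥ ] ≈ x
    zero-iff₁     : ∀ N S x → Elem N x → S ⊆ N → x |[ S ] ≈ 0# → x /[ S ] ≈ 0#
    zero-iff₂     : ∀ N S x → Elem N x → S ⊆ N → x /[ S ] ≈ 0# → x |[ S ] ≈ 0#
    zero-restrict : ∀ S → 0# |[ S ] ≈ 0#
    zero-contract : ∀ S → 0# /[ S ] ≈ 0#
    combinatorial : ∀ N S T x → Elem N x → S ⊆ T → T ⊆ N →
                    ¬ (x |[ S ] ≈ 0#) → ¬ (x |[ T ] ≈ 0#) →
                    ¬ ((x |[ T ]) /[ S ] ≈ 0#)

-- Raw data: a family p of subsets and a set I of intervals [X,Y],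
-- both as characteristic functions.
record RawCP (m : ℕ) : Set where
  constructor mkCP
  field
    p : Subset m → Bool
    I : Subset m → Subset m → Bool
open RawCP public

record IsColoringProblem {m : ℕ} (N : Subset m) (c : RawCP m) : Set where
  field
    p-sub   : ∀ X → T (p c X) → X ⊆ N
    p-empty : T (p c Sub.⊥)
    p-full  : T (p c N)
    I-int   : ∀ X Y → T (I c X Y) → T (p c X) × T (p c Y) × X ⊆ Y
    I-refl  : ∀ X → T (p c X) → T (I c X X)
    I-ideal : ∀ X Y X' Y' → T (I c X Y) → T (p c X') → T (p c Y') →
              X ⊆ X' → X' ⊆ Y' → Y' ⊆ Y → T (I c X' Y')

-- C_N = {0} ⊔ {coloring problems on N}; 0 is  nothing .
C : ℕ → Set
C m = Maybe (RawCP m)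

ElemC : ∀ {m} → Subset m → C m → Set
ElemC N nothing  = ⊤
ElemC N (just c) = IsColoringProblem N c

_≈C_ : ∀ {m} → C m → C m → Set
nothing ≈C nothing = ⊤
nothing ≈C just _  = Empty
just _  ≈C nothing = Empty
just c  ≈C just d  = (∀ X → p c X ≡ p d X) × (∀ X Y → I c X Y ≡ I d X Y)

-- relabelling along σ : (p , I) ↦ ({σ(S)} , {[σ(S),σ(T)]})
-- written out: X ∈ σ·p  iff  σ⁻¹(X) ∈ p
relabelC : ∀ {m} → Permutation′ m → C m → C m
relabelC σ nothing = nothing
relabelC σ (just c) =
  just (mkCP (λ X → p c (image (P.flip σ) X))
             (λ X Y → I c (image (P.flip σ) X) (image (P.flip σ) Y)))

restrictC : ∀ {m} → C m → Subset m → C m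
restrictC nothing S = nothing
restrictC (just c) S with p c S
... | false = nothing
... | true  = just (mkCP (λ X → p c X ∧ (X ⊆ᵇ S))
                         (λ X Y → I c X Y ∧ (Y ⊆ᵇ S)))

-- contraction c/S   (X ⊆ N∖S  is automatic from  X ∪ S ∈ p  and X ∩ S = ∅)
contractC : ∀ {m} → C m → Subset m → C m
contractC nothing S = nothing
contractC (just c) S with p c S
... | false = nothing
... | true  = just (mkCP (λ X → disjointᵇ X S ∧ p c (X ∪ S))
                         (λ X Y → (X ⊆ᵇ Y) ∧ (disjointᵇ Y S
                                   ∧ I c (X ∪ S) (Y ∪ S))))

ColoringSpecies : (m : ℕ) → SpeciesData m
ColoringSpecies m = record
  { A       = C m
  ; Elem    = ElemC
  ; _≈_     = _≈C_
  ; 0#      = nothing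
  ; relabel = relabelC
  ; _|[_]   = restrictC
  ; _/[_]   = contractC
  }

module Submission where

-- Each of restriction and contraction along S is guarded by the single condition S ∈ p
-- (relabelling is unguarded), so after normalising both sides of an axiom to the form
-- `when b c′` it splits into an equality of guards and an identity of coloring problems.
-- For R ⊆ S one has R ∈ p(c|S) ⇔ R ∈ p and S∖R ∈ p(c/R) ⇔ S ∈ p, so the composites
-- (c|S)/R, (c/R)|(S∖R), (c|S)|R and (c/R)/(S∖R) are all guarded by S ∈ p ∧ R ∈ p; this
-- gives coassociativity, and the combinatorial condition since (c|T)/S ≠ 0 once S, T ∈ p.
-- The identities of coloring problems are pointwise set algebra, the key instance being
-- that for X disjoint from R ⊆ S, X ∪ R ⊆ S ⇔ X ⊆ S∖R.

open import Defs
open import Data.Nat using (ℕ)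
open import Data.Bool using (Bool; true; false; _∧_; T; _≟_)
open import Data.Bool.Properties using (T-∧; T-≡; ∧-assoc; ∧-comm)
open import Data.Empty using (⊥-elim)
open import Data.Fin using (Fin)
open import Data.Fin.Subset using (Subset; _∈_; _∉_; _⊆_; _∪_; _∩_; _─_; outside)
  renaming (⊥ to ∅)
open import Data.Fin.Subset.Properties
  using (_∈?_; _⊆?_; ∉⊥; ⊥⊆; ⊆-refl; ⊆-trans; ⊆-antisym; Empty-unique;
         x∈p∩q⁺; x∈p∩q⁻; p⊆p∪q; q⊆p∪q; x∈p∪q⁻; x∈p∪q⁺; ∪-assoc;
         ∪-identityˡ; ∪-identityʳ; p─q⊆p; x∈p∧x∉q⇒x∈p─q)
open import Data.Fin.Permutation using (Permutation′; _⟨$⟩ˡ_; _∘ₚ_; inverseˡ; inverseʳ)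
import Data.Fin.Permutation as P
open import Data.Vec using (_∷_; here; there; tabulate; lookup)
open import Data.Vec.Properties
  using (lookup∘tabulate; tabulate∘lookup; tabulate-cong; []=⇒lookup; lookup⇒[]=; ≡-dec)
open import Data.Maybe using (just; nothing; when)
open import Data.Product using (_×_; _,_; proj₁; proj₂; ∃)
open import Data.Sum using ([_,_])
import Data.Sum as Sum
open import Data.Unit using (tt)
open import Function using (_∘_)
open import Function.Bundles using (_⇔_; mk⇔; Equivalence)
open Equivalence using (to; from)
import Function.Properties.Equivalence as ⇔
open import Data.Product.Function.NonDependent.Propositional using (_×-⇔_)
open import Relation.Nullary using (¬_; yes; no; contradiction)
open import Relation.Nullary.Decidable using (toWitness; fromWitness)
open import Relation.Binary.Bundles using (Setoid)
import Relation.Binary.Reasoning.Setoid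
open import Relation.Binary.PropositionalEquality
  using (_≡_; refl; sym; trans; cong; cong₂; subst; subst₂; module ≡-Reasoning)

private
  variable
    n : ℕ
    X Y Z R S N : Subset n
    a b : Bool

-- Subsets

x∈p─q⇒x∉q : ∀ {x : Fin n} (p q : Subset n) → x ∈ p ─ q → x ∉ q
x∈p─q⇒x∉q (_ ∷ p) (outside ∷ q) here       ()
x∈p─q⇒x∉q (_ ∷ p) (_       ∷ q) (there x∈) (there x∈q) = x∈p─q⇒x∉q p q x∈ x∈q

Disjoint : Subset n → Subset n → Set
Disjoint X Y = ∀ {x} → x ∈ X → x ∉ Y

─-disjoint : Disjoint (S ─ R) R
─-disjoint {S = S} {R = R} = x∈p─q⇒x∉q S R

∪-monoˡ-⊆ : X ⊆ Y → X ∪ Z ⊆ Y ∪ Z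
∪-monoˡ-⊆ {X = X} {Y = Y} {Z = Z} X⊆Y = [ p⊆p∪q Z ∘ X⊆Y , q⊆p∪q Y Z ] ∘ x∈p∪q⁻ X Z

p─q∪q≡p : R ⊆ S → (S ─ R) ∪ R ≡ S
p─q∪q≡p {R = R} {S = S} R⊆S =
  ⊆-antisym ([ p─q⊆p S R , R⊆S ] ∘ x∈p∪q⁻ (S ─ R) R) S⊆S─R∪R
  where
  S⊆S─R∪R : S ⊆ (S ─ R) ∪ R
  S⊆S─R∪R {x} x∈S with x ∈? R
  ... | yes x∈R = q⊆p∪q (S ─ R) R x∈R
  ... | no  x∉R = p⊆p∪q R (x∈p∧x∉q⇒x∈p─q x∈S x∉R)

∪─∪≡∪ : R ⊆ S → (X ∪ (S ─ R)) ∪ R ≡ X ∪ S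
∪─∪≡∪ {R = R} {S = S} {X = X} R⊆S =
  trans (∪-assoc X (S ─ R) R) (cong (X ∪_) (p─q∪q≡p R⊆S))

∪⊆⇒⊆─ : Disjoint X R → X ∪ R ⊆ S → X ⊆ S ─ R
∪⊆⇒⊆─ {R = R} X#R X∪R⊆S x∈X = x∈p∧x∉q⇒x∈p─q (X∪R⊆S (p⊆p∪q R x∈X)) (X#R x∈X)

⊆─⇒∪⊆ : R ⊆ S → X ⊆ S ─ R → X ∪ R ⊆ S
⊆─⇒∪⊆ {R = R} {S = S} {X = X} R⊆S X⊆S─R = [ p─q⊆p S R ∘ X⊆S─R , R⊆S ] ∘ x∈p∪q⁻ X R

disjoint-split : R ⊆ S → Disjoint X S ⇔ (Disjoint X (S ─ R) × Disjoint (X ∪ (S ─ R)) R)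
disjoint-split {R = R} {S = S} {X = X} R⊆S = mk⇔ split join
  where
  split : Disjoint X S → Disjoint X (S ─ R) × Disjoint (X ∪ (S ─ R)) R
  split X#S = (λ x∈X → X#S x∈X ∘ p─q⊆p S R)
            , (λ x∈ → [ (λ x∈X → X#S x∈X ∘ R⊆S) , x∈p─q⇒x∉q S R ] (x∈p∪q⁻ X (S ─ R) x∈))

  join : Disjoint X (S ─ R) × Disjoint (X ∪ (S ─ R)) R → Disjoint X S
  join (X#S─R , X∪S─R#R) {x} x∈X x∈S with x ∈? R
  ... | yes x∈R = X∪S─R#R (p⊆p∪q (S ─ R) x∈X) x∈R
  ... | no  x∉R = X#S─R x∈X (x∈p∧x∉q⇒x∈p─q x∈S x∉R)

-- Boolean reflections

T-⇔→≡ : T a ⇔ T b → a ≡ b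
T-⇔→≡ {false} {false} _ = refl
T-⇔→≡ {false} {true}  h = ⊥-elim (h .from _)
T-⇔→≡ {true}  {false} h = ⊥-elim (h .to _)
T-⇔→≡ {true}  {true}  _ = refl

∧-intro : T a → T b → T (a ∧ b)
∧-intro a b = T-∧ .from (a , b)

∧-congˡ-T : ∀ a {b d} → (T a → b ≡ d) → a ∧ b ≡ a ∧ d
∧-congˡ-T false _   = refl
∧-congˡ-T true  b≡d = b≡d _

∧-redundantˡ : ∀ a {b} → (T b → T a) → a ∧ b ≡ b
∧-redundantˡ a b⇒a = T-⇔→≡ (mk⇔ (proj₂ ∘ T-∧ .to) (λ b → ∧-intro (b⇒a b) b))

∧-redundantʳ : ∀ a {b} → (T a → T b) → a ∧ b ≡ a
∧-redundantʳ a a⇒b = T-⇔→≡ (mk⇔ (proj₁ ∘ T-∧ .to) (λ a → ∧-intro a (a⇒b a)))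

T-⊆ᵇ : T (X ⊆ᵇ Y) ⇔ X ⊆ Y
T-⊆ᵇ {X = X} {Y = Y} = mk⇔ (toWitness {a? = X ⊆? Y}) fromWitness

T-disjointᵇ : T (disjointᵇ X Y) ⇔ Disjoint X Y
T-disjointᵇ {X = X} {Y = Y} = mk⇔ disjoint (fromWitness ∘ Empty-unique ∘ empty)
  where
  disjoint : T (disjointᵇ X Y) → Disjoint X Y
  disjoint t {x} x∈X x∈Y =
    ∉⊥ (subst (x ∈_) (toWitness {a? = ≡-dec _≟_ (X ∩ Y) ∅} t) (x∈p∩q⁺ (x∈X , x∈Y)))

  empty : Disjoint X Y → ¬ (∃ λ x → x ∈ X ∩ Y)
  empty X#Y (_ , x∈X∩Y) = let x∈X , x∈Y = x∈p∩q⁻ X Y x∈X∩Y in X#Y x∈X x∈Y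

⊆ᵇ-cong : ∀ {X Y X′ Y′ : Subset n} → X ⊆ Y ⇔ X′ ⊆ Y′ → X ⊆ᵇ Y ≡ X′ ⊆ᵇ Y′
⊆ᵇ-cong h = T-⇔→≡ (⇔.trans T-⊆ᵇ (⇔.trans h (⇔.sym T-⊆ᵇ)))

disjointᵇ-cong : ∀ {X Y X′ Y′ : Subset n} →
                 Disjoint X Y ⇔ Disjoint X′ Y′ → disjointᵇ X Y ≡ disjointᵇ X′ Y′
disjointᵇ-cong h = T-⇔→≡ (⇔.trans T-disjointᵇ (⇔.trans h (⇔.sym T-disjointᵇ)))

disjointᵇ-split : R ⊆ S → disjointᵇ X S ≡ disjointᵇ X (S ─ R) ∧ disjointᵇ (X ∪ (S ─ R)) R
disjointᵇ-split R⊆S = T-⇔→≡ (⇔.trans T-disjointᵇ (⇔.trans (disjoint-split R⊆S)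
                        (⇔.sym (⇔.trans T-∧ (T-disjointᵇ ×-⇔ T-disjointᵇ)))))

-- Images along permutations

module _ {m : ℕ} where

  private
    variable
      U V : Subset m

  ∈-image : ∀ (ρ : Permutation′ m) U {x} → x ∈ image ρ U ⇔ ρ ⟨$⟩ˡ x ∈ U
  ∈-image ρ U {x} = mk⇔
    (λ x∈ → lookup⇒[]= _ U (trans (sym (lookup∘tabulate _ x)) ([]=⇒lookup x∈)))
    (λ ρx∈ → lookup⇒[]= x _ (trans (lookup∘tabulate _ x) ([]=⇒lookup ρx∈)))

  image-mono : ∀ (ρ : Permutation′ m) → U ⊆ V → image ρ U ⊆ image ρ V
  image-mono {U = U} {V = V} ρ U⊆V x∈ = ∈-image ρ V .from (U⊆V (∈-image ρ U .to x∈))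

  image-disjoint : ∀ (ρ : Permutation′ m) → Disjoint U V → Disjoint (image ρ U) (image ρ V)
  image-disjoint {U = U} {V = V} ρ U#V x∈ρU x∈ρV =
    U#V (∈-image ρ U .to x∈ρU) (∈-image ρ V .to x∈ρV)

  image-∪ : ∀ (ρ : Permutation′ m) U V → image ρ (U ∪ V) ≡ image ρ U ∪ image ρ V
  image-∪ ρ U V = ⊆-antisym
    (λ x∈ → x∈p∪q⁺ (Sum.map (∈-image ρ U .from) (∈-image ρ V .from)
                              (x∈p∪q⁻ U V (∈-image ρ (U ∪ V) .to x∈))))
    (λ x∈ → ∈-image ρ (U ∪ V) .from
              (x∈p∪q⁺ (Sum.map (∈-image ρ U .to) (∈-image ρ V .to) (x∈p∪q⁻ _ _ x∈))))

  image-∅ : ∀ (ρ : Permutation′ m) → image ρ ∅ ≡ ∅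
  image-∅ ρ = ⊆-antisym (λ x∈ → contradiction (∈-image ρ ∅ .to x∈) ∉⊥) ⊥⊆

  image-≗id : ∀ (ρ : Permutation′ m) → (∀ j → ρ ⟨$⟩ˡ j ≡ j) → image ρ U ≡ U
  image-≗id {U = U} ρ ρ≗id = trans (tabulate-cong (cong (lookup U) ∘ ρ≗id)) (tabulate∘lookup U)

  image-image : ∀ (ρ τ : Permutation′ m) U → image ρ (image τ U) ≡ image (τ ∘ₚ ρ) U
  image-image ρ τ U = tabulate-cong (λ j → lookup∘tabulate _ (ρ ⟨$⟩ˡ j))

  image-flip-image : ∀ (σ : Permutation′ m) U → image (P.flip σ) (image σ U) ≡ U
  image-flip-image σ U =
    trans (image-image (P.flip σ) σ U) (image-≗id (σ ∘ₚ P.flip σ) (λ _ → inverseˡ σ))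

  image-image-flip : ∀ (σ : Permutation′ m) U → image σ (image (P.flip σ) U) ≡ U
  image-image-flip σ U =
    trans (image-image σ (P.flip σ) U) (image-≗id (P.flip σ ∘ₚ σ) (λ _ → inverseʳ σ))

  module ImageInvariant
    (_∼_ : Subset m → Subset m → Set)
    (image-pres : ∀ (ρ : Permutation′ m) {U V} → U ∼ V → image ρ U ∼ image ρ V)
    where

    image⇔ : ∀ (ρ : Permutation′ m) → image ρ U ∼ image ρ V ⇔ U ∼ V
    image⇔ {U = U} {V = V} ρ = mk⇔
      (subst₂ _∼_ (image-flip-image ρ U) (image-flip-image ρ V) ∘ image-pres (P.flip ρ))
      (image-pres ρ)

    transpose : ∀ (σ : Permutation′ m) → U ∼ image σ V ⇔ image (P.flip σ) U ∼ V
    transpose {U = U} {V = V} σ = mk⇔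
      (subst (image (P.flip σ) U ∼_) (image-flip-image σ V) ∘ image-pres (P.flip σ))
      (subst (_∼ image σ V) (image-image-flip σ U) ∘ image-pres σ)

  module ⊆-image = ImageInvariant _⊆_ (λ ρ → image-mono ρ)
  module Disjoint-image = ImageInvariant Disjoint (λ ρ → image-disjoint ρ)

  ⊆ᵇ-image : ∀ (ρ : Permutation′ m) U V → image ρ U ⊆ᵇ image ρ V ≡ U ⊆ᵇ V
  ⊆ᵇ-image ρ U V = ⊆ᵇ-cong (⊆-image.image⇔ ρ)

  ⊆ᵇ-transpose : ∀ (σ : Permutation′ m) U V → U ⊆ᵇ image σ V ≡ image (P.flip σ) U ⊆ᵇ V
  ⊆ᵇ-transpose σ U V = ⊆ᵇ-cong (⊆-image.transpose σ)

  disjointᵇ-transpose : ∀ (σ : Permutation′ m) U V →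
                        disjointᵇ U (image σ V) ≡ disjointᵇ (image (P.flip σ) U) V
  disjointᵇ-transpose σ U V = disjointᵇ-cong (Disjoint-image.transpose σ)

  image-flip-∪ : ∀ (σ : Permutation′ m) U V →
                 image (P.flip σ) (U ∪ image σ V) ≡ image (P.flip σ) U ∪ V
  image-flip-∪ σ U V = trans (image-∪ (P.flip σ) U (image σ V)) (cong (_ ∪_) (image-flip-image σ V))

-- Coloring problems

module _ {m : ℕ} where

  private
    variable
      c : RawCP m
      x y z : C m

  restrictCP : RawCP m → Subset m → RawCP m
  restrictCP c S = mkCP (λ X → p c X ∧ (X ⊆ᵇ S)) (λ X Y → I c X Y ∧ (Y ⊆ᵇ S))

  contractCP : RawCP m → Subset m → RawCP m
  contractCP c S = mkCP (λ X → disjointᵇ X S ∧ p c (X ∪ S))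
                        (λ X Y → (X ⊆ᵇ Y) ∧ (disjointᵇ Y S ∧ I c (X ∪ S) (Y ∪ S)))

  relabelCP : Permutation′ m → RawCP m → RawCP m
  relabelCP σ c = mkCP (λ X → p c (image (P.flip σ) X))
                       (λ X Y → I c (image (P.flip σ) X) (image (P.flip σ) Y))

  infix 4 _≈CP_
  _≈CP_ : RawCP m → RawCP m → Set
  c ≈CP d = (∀ X → p c X ≡ p d X) × (∀ X Y → I c X Y ≡ I d X Y)

  ≈C-refl : x ≈C x
  ≈C-refl {x = nothing} = tt
  ≈C-refl {x = just c}  = (λ _ → refl) , (λ _ _ → refl)

  ≈C-sym : x ≈C y → y ≈C x
  ≈C-sym {x = nothing} {y = nothing} _           = tt
  ≈C-sym {x = just _}  {y = just _}  (p≡ , I≡) = (sym ∘ p≡) , (λ X Y → sym (I≡ X Y))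

  ≈C-trans : x ≈C y → y ≈C z → x ≈C z
  ≈C-trans {x = nothing} {y = nothing} {z = nothing} _ _ = tt
  ≈C-trans {x = just _} {y = just _} {z = just _} (p≡ , I≡) (p≡′ , I≡′) =
    (λ X → trans (p≡ X) (p≡′ X)) , (λ X Y → trans (I≡ X Y) (I≡′ X Y))

  C-setoid : Setoid _ _
  C-setoid = record
    { Carrier       = C m
    ; _≈_           = _≈C_
    ; isEquivalence = record { refl = ≈C-refl ; sym = ≈C-sym ; trans = ≈C-trans }
    }

  restrictC-when : ∀ b c S → restrictC (when b c) S ≡ when (b ∧ p c S) (restrictCP c S)
  restrictC-when false c S = refl
  restrictC-when true  c S with p c S
  ... | true  = refl
  ... | false = refl

  contractC-when : ∀ b c S → contractC (when b c) S ≡ when (b ∧ p c S) (contractCP c S)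
  contractC-when false c S = refl
  contractC-when true  c S with p c S
  ... | true  = refl
  ... | false = refl

  relabelC-when : ∀ σ b c → relabelC σ (when b c) ≡ when b (relabelCP σ c)
  relabelC-when σ false c = refl
  relabelC-when σ true  c = refl

  when-cong : ∀ {a b} {c d : RawCP m} → a ≡ b → (T a → c ≈CP d) → when a c ≈C when b d
  when-cong {false} refl _   = tt
  when-cong {true}  refl c≈d = c≈d _

  when-elem : ∀ {b} {c : RawCP m} → (T b → IsColoringProblem N c) → ElemC N (when b c)
  when-elem {b = false} _    = tt
  when-elem {b = true}  cp = cp _

  when-≈0-cong : ∀ b (c d : RawCP m) → when b c ≈C nothing → when b d ≈C nothing
  when-≈0-cong false _ _ _ = tt

  when-≉0⇒T : ∀ {b} {c : RawCP m} → ¬ (when b c ≈C nothing) → T b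
  when-≉0⇒T {false} ≉0 = ≉0 tt
  when-≉0⇒T {true}  _  = _

  T⇒when-≉0 : ∀ {b} {c : RawCP m} → T b → ¬ (when b c ≈C nothing)
  T⇒when-≉0 {true} _ ()

  p-restrictCP : ∀ c → R ⊆ S → p (restrictCP c S) R ≡ p c R
  p-restrictCP {R = R} c R⊆S = ∧-redundantʳ (p c R) (λ _ → T-⊆ᵇ .from R⊆S)

  p-contractCP : ∀ c → R ⊆ S → p (contractCP c R) (S ─ R) ≡ p c S
  p-contractCP c R⊆S =
    cong₂ _∧_ (T-≡ .to (T-disjointᵇ .from ─-disjoint)) (cong (p c) (p─q∪q≡p R⊆S))

  p-relabelCP : ∀ σ c S → p (relabelCP σ c) (image σ S) ≡ p c S
  p-relabelCP σ c S = cong (p c) (image-flip-image σ S)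

  relabelCP-id : ∀ c → relabelCP P.id c ≈CP c
  relabelCP-id c = (λ X → cong (p c) (id≗ X)) , (λ X Y → cong₂ (I c) (id≗ X) (id≗ Y))
    where
    id≗ : ∀ X → image (P.flip P.id) X ≡ X
    id≗ X = image-≗id (P.flip P.id) (λ _ → refl)

  relabelCP-∘ : ∀ σ τ c → relabelCP (σ ∘ₚ τ) c ≈CP relabelCP τ (relabelCP σ c)
  relabelCP-∘ σ τ c = (λ X → cong (p c) (∘≗ X)) , (λ X Y → cong₂ (I c) (∘≗ X) (∘≗ Y))
    where
    ∘≗ : ∀ X → image (P.flip (σ ∘ₚ τ)) X ≡ image (P.flip σ) (image (P.flip τ) X)
    ∘≗ X = sym (image-image (P.flip σ) (P.flip τ) X)

  restrictCP-relabelCP : ∀ σ c S →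
                         restrictCP (relabelCP σ c) (image σ S) ≈CP relabelCP σ (restrictCP c S)
  restrictCP-relabelCP σ c S = (λ X → cong (_ ∧_) (⊆ᵇ-transpose σ X S))
                             , (λ X Y → cong (_ ∧_) (⊆ᵇ-transpose σ Y S))

  contractCP-relabelCP : ∀ σ c S →
                         contractCP (relabelCP σ c) (image σ S) ≈CP relabelCP σ (contractCP c S)
  contractCP-relabelCP σ c S =
      (λ X → cong₂ _∧_ (disjointᵇ-transpose σ X S) (cong (p c) (image-flip-∪ σ X S)))
    , (λ X Y → cong₂ _∧_ (sym (⊆ᵇ-image (P.flip σ) X Y))
                 (cong₂ _∧_ (disjointᵇ-transpose σ Y S)
                   (cong₂ (I c) (image-flip-∪ σ X S) (image-flip-∪ σ Y S))))

  restrictCP-restrictCP : ∀ c → R ⊆ S → restrictCP (restrictCP c S) R ≈CP restrictCP c R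
  restrictCP-restrictCP {R = R} {S = S} c R⊆S =
    (λ X → ⊆ᵇS-redundant (p c X) X) , (λ X Y → ⊆ᵇS-redundant (I c X Y) Y)
    where
    ⊆ᵇS-redundant : ∀ a X → (a ∧ (X ⊆ᵇ S)) ∧ (X ⊆ᵇ R) ≡ a ∧ (X ⊆ᵇ R)
    ⊆ᵇS-redundant a X = trans (∧-assoc a _ _) (cong (a ∧_) (∧-redundantˡ (X ⊆ᵇ S)
      (λ X⊆R → T-⊆ᵇ .from (⊆-trans (T-⊆ᵇ .to X⊆R) R⊆S))))

  contractCP-restrictCP : ∀ c → R ⊆ S →
                          contractCP (restrictCP c S) R ≈CP restrictCP (contractCP c R) (S ─ R)
  contractCP-restrictCP {R = R} {S = S} c R⊆S =
      (λ X → reassoc (disjointᵇ X R) _ (∪⊆ᵇ X))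
    , (λ X Y → trans (cong ((X ⊆ᵇ Y) ∧_) (reassoc (disjointᵇ Y R) _ (∪⊆ᵇ Y)))
                     (sym (∧-assoc (X ⊆ᵇ Y) _ _)))
    where
    ∪⊆ᵇ : ∀ X → T (disjointᵇ X R) → (X ∪ R) ⊆ᵇ S ≡ X ⊆ᵇ (S ─ R)
    ∪⊆ᵇ X X#R = ⊆ᵇ-cong (mk⇔ (∪⊆⇒⊆─ (T-disjointᵇ .to X#R)) (⊆─⇒∪⊆ R⊆S))

    reassoc : ∀ a b {u v} → (T a → u ≡ v) → a ∧ (b ∧ u) ≡ (a ∧ b) ∧ v
    reassoc a b u≡v = trans (∧-congˡ-T a (cong (b ∧_) ∘ u≡v)) (sym (∧-assoc a b _))

  contractCP-contractCP : ∀ c → R ⊆ S →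
                          contractCP c S ≈CP contractCP (contractCP c R) (S ─ R)
  contractCP-contractCP {R = R} {S = S} c R⊆S =
      (λ X → trans (split X) (cong (λ Z → disjointᵇ X (S ─ R) ∧ (disjointᵇ (X ∪ (S ─ R)) R ∧ p c Z))
                                   (sym (∪─∪≡∪ R⊆S))))
    , (λ X Y → ∧-congˡ-T (X ⊆ᵇ Y) (I-part X Y))
    where
    split : ∀ X {b} → disjointᵇ X S ∧ b ≡ disjointᵇ X (S ─ R) ∧ (disjointᵇ (X ∪ (S ─ R)) R ∧ b)
    split X {b} = trans (cong (_∧ b) (disjointᵇ-split {X = X} R⊆S))
                        (∧-assoc (disjointᵇ X (S ─ R)) (disjointᵇ (X ∪ (S ─ R)) R) b)

    I-part : ∀ X Y → T (X ⊆ᵇ Y) →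
             disjointᵇ Y S ∧ I c (X ∪ S) (Y ∪ S)
               ≡ disjointᵇ Y (S ─ R) ∧ I (contractCP c R) (X ∪ (S ─ R)) (Y ∪ (S ─ R))
    I-part X Y X⊆Y = begin
      disjointᵇ Y S ∧ I c (X ∪ S) (Y ∪ S)
        ≡⟨ split Y ⟩
      d₁ ∧ (d₂ ∧ I c (X ∪ S) (Y ∪ S))
        ≡⟨ cong (λ u → d₁ ∧ (u ∧ (d₂ ∧ I c (X ∪ S) (Y ∪ S)))) (sym ⊆ᵇ-true) ⟩
      d₁ ∧ (s ∧ (d₂ ∧ I c (X ∪ S) (Y ∪ S)))
        ≡⟨ cong₂ (λ U V → d₁ ∧ (s ∧ (d₂ ∧ I c U V))) (sym (∪─∪≡∪ R⊆S)) (sym (∪─∪≡∪ R⊆S)) ⟩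
      d₁ ∧ I (contractCP c R) (X ∪ (S ─ R)) (Y ∪ (S ─ R)) ∎
      where
      open ≡-Reasoning
      d₁ d₂ s : Bool
      d₁ = disjointᵇ Y (S ─ R)
      d₂ = disjointᵇ (Y ∪ (S ─ R)) R
      s  = (X ∪ (S ─ R)) ⊆ᵇ (Y ∪ (S ─ R))
      ⊆ᵇ-true : s ≡ true
      ⊆ᵇ-true = T-≡ .to (T-⊆ᵇ .from (∪-monoˡ-⊆ (T-⊆ᵇ .to X⊆Y)))

  restrictCP-full : IsColoringProblem N c → restrictCP c N ≈CP c
  restrictCP-full {c = c} cp =
      (λ X → ∧-redundantʳ (p c X) (λ X∈p → T-⊆ᵇ .from (p-sub X X∈p)))
    , (λ X Y → ∧-redundantʳ (I c X Y)
                 (λ XY∈I → T-⊆ᵇ .from (p-sub Y (proj₁ (proj₂ (I-int X Y XY∈I))))))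
    where open IsColoringProblem cp

  contractCP-∅ : IsColoringProblem N c → contractCP c ∅ ≈CP c
  contractCP-∅ {c = c} cp =
      (λ X → cong₂ _∧_ (#∅ X) (cong (p c) (∪-identityʳ X)))
    , (λ X Y → trans (cong₂ (λ d i → (X ⊆ᵇ Y) ∧ (d ∧ i)) (#∅ Y)
                        (cong₂ (I c) (∪-identityʳ X) (∪-identityʳ Y)))
                     (∧-redundantˡ (X ⊆ᵇ Y) (λ XY∈I → T-⊆ᵇ .from (proj₂ (proj₂ (I-int X Y XY∈I))))))
    where
    open IsColoringProblem cp
    #∅ : ∀ X → disjointᵇ X ∅ ≡ true
    #∅ X = T-≡ .to (T-disjointᵇ .from (λ _ → ∉⊥))

  restrictCP-isColoringProblem : IsColoringProblem N c → T (p c S) →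
                                 IsColoringProblem S (restrictCP c S)
  restrictCP-isColoringProblem {c = c} {S = S} cp S∈p = record
    { p-sub   = λ X t → T-⊆ᵇ .to (proj₂ (T-∧ .to t))
    ; p-empty = ∧-intro p-empty (T-⊆ᵇ .from ⊥⊆)
    ; p-full  = ∧-intro S∈p (T-⊆ᵇ .from ⊆-refl)
    ; I-int   = λ X Y t →
        let XY∈I , Y⊆S = T-∧ .to t
            X∈p , Y∈p , X⊆Y = I-int X Y XY∈I
        in ∧-intro X∈p (T-⊆ᵇ .from (⊆-trans X⊆Y (T-⊆ᵇ .to Y⊆S))) , ∧-intro Y∈p Y⊆S , X⊆Y
    ; I-refl  = λ X t → let X∈p , X⊆S = T-∧ .to t in ∧-intro (I-refl X X∈p) X⊆S
    ; I-ideal = λ X Y X′ Y′ t tX′ tY′ X⊆X′ X′⊆Y′ Y′⊆Y →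
        let Y′∈p , Y′⊆S = T-∧ .to tY′ in
        ∧-intro (I-ideal X Y X′ Y′ (proj₁ (T-∧ .to t)) (proj₁ (T-∧ .to tX′)) Y′∈p X⊆X′ X′⊆Y′ Y′⊆Y)
                Y′⊆S
    }
    where open IsColoringProblem cp

  contractCP-isColoringProblem : IsColoringProblem N c → T (p c S) →
                                 IsColoringProblem (N ─ S) (contractCP c S)
  contractCP-isColoringProblem {N = N} {c = c} {S = S} cp S∈p = record
    { p-sub   = λ X t → let X#S , X∪S∈p = T-∧ .to t in
        ∪⊆⇒⊆─ (T-disjointᵇ .to X#S) (p-sub (X ∪ S) X∪S∈p)
    ; p-empty = ∧-intro (T-disjointᵇ .from (λ x∈∅ _ → ∉⊥ x∈∅))
                        (subst (T ∘ p c) (sym (∪-identityˡ S)) S∈p)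
    ; p-full  = ∧-intro (T-disjointᵇ .from ─-disjoint)
                        (subst (T ∘ p c) (sym (p─q∪q≡p (p-sub S S∈p))) p-full)
    ; I-int   = λ X Y t →
        let X⊆Y , rest = T-∧ {X ⊆ᵇ Y} .to t
            Y#S , XY∈I = T-∧ .to rest
            X∪S∈p , Y∪S∈p , _ = I-int (X ∪ S) (Y ∪ S) XY∈I
        in ∧-intro (T-disjointᵇ .from (λ x∈X → T-disjointᵇ .to Y#S (T-⊆ᵇ .to X⊆Y x∈X))) X∪S∈p
         , ∧-intro Y#S Y∪S∈p
         , T-⊆ᵇ .to X⊆Y
    ; I-refl  = λ X t → let X#S , X∪S∈p = T-∧ .to t in
        ∧-intro {a = X ⊆ᵇ X} (T-⊆ᵇ .from ⊆-refl) (∧-intro X#S (I-refl (X ∪ S) X∪S∈p))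
    ; I-ideal = λ X Y X′ Y′ t tX′ tY′ X⊆X′ X′⊆Y′ Y′⊆Y →
        let _ , rest = T-∧ {X ⊆ᵇ Y} .to t
            _ , XY∈I = T-∧ {disjointᵇ Y S} .to rest
            _ , X′∪S∈p = T-∧ .to tX′
            Y′#S , Y′∪S∈p = T-∧ .to tY′
        in ∧-intro (T-⊆ᵇ .from X′⊆Y′)
                   (∧-intro Y′#S (I-ideal (X ∪ S) (Y ∪ S) (X′ ∪ S) (Y′ ∪ S) XY∈I X′∪S∈p Y′∪S∈p
                                    (∪-monoˡ-⊆ X⊆X′) (∪-monoˡ-⊆ X′⊆Y′) (∪-monoˡ-⊆ Y′⊆Y)))
    }
    where open IsColoringProblem cp

  relabelCP-isColoringProblem : ∀ σ → IsColoringProblem N c →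
                                IsColoringProblem (image σ N) (relabelCP σ c)
  relabelCP-isColoringProblem {N = N} {c = c} σ cp = record
    { p-sub   = λ X t → ⊆-image.transpose σ .from (p-sub _ t)
    ; p-empty = subst (T ∘ p c) (sym (image-∅ (P.flip σ))) p-empty
    ; p-full  = subst (T ∘ p c) (sym (image-flip-image σ N)) p-full
    ; I-int   = λ X Y t → let X∈p , Y∈p , X⊆Y = I-int _ _ t in
        X∈p , Y∈p , ⊆-image.image⇔ (P.flip σ) .to X⊆Y
    ; I-refl  = λ X → I-refl _
    ; I-ideal = λ X Y X′ Y′ t tX′ tY′ X⊆X′ X′⊆Y′ Y′⊆Y →
        I-ideal _ _ _ _ t tX′ tY′ (image-mono (P.flip σ) X⊆X′) (image-mono (P.flip σ) X′⊆Y′)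
                                  (image-mono (P.flip σ) Y′⊆Y)
    }
    where open IsColoringProblem cp

  restrictC-just : ∀ c S → restrictC (just c) S ≡ when (p c S) (restrictCP c S)
  restrictC-just = restrictC-when true

  contractC-just : ∀ c S → contractC (just c) S ≡ when (p c S) (contractCP c S)
  contractC-just = contractC-when true

  nested-when : ∀ (op : C m → Subset m → C m) {opCP : RawCP m → Subset m → RawCP m} →
                (∀ b c S → op (when b c) S ≡ when (b ∧ p c S) (opCP c S)) →
                ∀ a c R {x b} → x ≡ when a c → p c R ≡ b → op x R ≡ when (a ∧ b) (opCP c R)
  nested-when _ op-when a c R refl refl = op-when a c R

  restrictC²-when : ∀ c → R ⊆ S →
    restrictC (restrictC (just c) S) R ≡ when (p c S ∧ p c R) (restrictCP (restrictCP c S) R)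
  restrictC²-when {R = R} {S = S} c R⊆S =
    nested-when restrictC restrictC-when
      (p c S) (restrictCP c S) R (restrictC-just c S) (p-restrictCP c R⊆S)

  contractC-restrictC-when : ∀ c → R ⊆ S →
    contractC (restrictC (just c) S) R ≡ when (p c S ∧ p c R) (contractCP (restrictCP c S) R)
  contractC-restrictC-when {R = R} {S = S} c R⊆S =
    nested-when contractC contractC-when
      (p c S) (restrictCP c S) R (restrictC-just c S) (p-restrictCP c R⊆S)

  restrictC-contractC-when : ∀ c → R ⊆ S →
    restrictC (contractC (just c) R) (S ─ R)
      ≡ when (p c R ∧ p c S) (restrictCP (contractCP c R) (S ─ R))
  restrictC-contractC-when {R = R} {S = S} c R⊆S =
    nested-when restrictC restrictC-when
      (p c R) (contractCP c R) (S ─ R) (contractC-just c R) (p-contractCP c R⊆S)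

  contractC²-when : ∀ c → R ⊆ S →
    contractC (contractC (just c) R) (S ─ R)
      ≡ when (p c R ∧ p c S) (contractCP (contractCP c R) (S ─ R))
  contractC²-when {R = R} {S = S} c R⊆S =
    nested-when contractC contractC-when
      (p c R) (contractCP c R) (S ─ R) (contractC-just c R) (p-contractCP c R⊆S)

  module ≈C-Reasoning = Relation.Binary.Reasoning.Setoid C-setoid

  relabelC-elem : ∀ σ N x → ElemC N x → ElemC (image σ N) (relabelC σ x)
  relabelC-elem σ N nothing  _  = tt
  relabelC-elem σ N (just c) cp = relabelCP-isColoringProblem σ cp

  relabelC-id : ∀ N x → ElemC N x → relabelC P.id x ≈C x
  relabelC-id N nothing  _ = tt
  relabelC-id N (just c) _ = relabelCP-id c

  relabelC-∘ : ∀ σ τ N x → ElemC N x → relabelC (σ ∘ₚ τ) x ≈C relabelC τ (relabelC σ x)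
  relabelC-∘ σ τ N nothing  _ = tt
  relabelC-∘ σ τ N (just c) _ = relabelCP-∘ σ τ c

  restrictC-elem : ∀ N S x → ElemC N x → S ⊆ N → ElemC S (restrictC x S)
  restrictC-elem N S nothing  _  _ = tt
  restrictC-elem N S (just c) cp _ =
    subst (ElemC S) (sym (restrictC-just c S)) (when-elem (restrictCP-isColoringProblem cp))

  contractC-elem : ∀ N S x → ElemC N x → S ⊆ N → ElemC (N ─ S) (contractC x S)
  contractC-elem N S nothing  _  _ = tt
  contractC-elem N S (just c) cp _ =
    subst (ElemC (N ─ S)) (sym (contractC-just c S)) (when-elem (contractCP-isColoringProblem cp))

  restrictC-relabelC : ∀ σ N S x → ElemC N x → S ⊆ N →
                       restrictC (relabelC σ x) (image σ S) ≈C relabelC σ (restrictC x S)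
  restrictC-relabelC σ N S nothing  _ _ = tt
  restrictC-relabelC σ N S (just c) _ _ = begin
    restrictC (just (relabelCP σ c)) (image σ S)
      ≡⟨ restrictC-just (relabelCP σ c) (image σ S) ⟩
    when (p (relabelCP σ c) (image σ S)) (restrictCP (relabelCP σ c) (image σ S))
      ≈⟨ when-cong (p-relabelCP σ c S) (λ _ → restrictCP-relabelCP σ c S) ⟩
    when (p c S) (relabelCP σ (restrictCP c S))
      ≡⟨ trans (cong (relabelC σ) (restrictC-just c S)) (relabelC-when σ (p c S) (restrictCP c S)) ⟨
    relabelC σ (restrictC (just c) S) ∎
    where open ≈C-Reasoning

  contractC-relabelC : ∀ σ N S x → ElemC N x → S ⊆ N →
                       contractC (relabelC σ x) (image σ S) ≈C relabelC σ (contractC x S)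
  contractC-relabelC σ N S nothing  _ _ = tt
  contractC-relabelC σ N S (just c) _ _ = begin
    contractC (just (relabelCP σ c)) (image σ S)
      ≡⟨ contractC-just (relabelCP σ c) (image σ S) ⟩
    when (p (relabelCP σ c) (image σ S)) (contractCP (relabelCP σ c) (image σ S))
      ≈⟨ when-cong (p-relabelCP σ c S) (λ _ → contractCP-relabelCP σ c S) ⟩
    when (p c S) (relabelCP σ (contractCP c S))
      ≡⟨ trans (cong (relabelC σ) (contractC-just c S)) (relabelC-when σ (p c S) (contractCP c S)) ⟨
    relabelC σ (contractC (just c) S) ∎
    where open ≈C-Reasoning

  contractC-restrictC : ∀ N S R x → ElemC N x → R ⊆ S → S ⊆ N →
                        contractC (restrictC x S) R ≈C restrictC (contractC x R) (S ─ R)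
  contractC-restrictC N S R nothing  _ _   _ = tt
  contractC-restrictC N S R (just c) _ R⊆S _ = begin
    contractC (restrictC (just c) S) R
      ≡⟨ contractC-restrictC-when c R⊆S ⟩
    when (p c S ∧ p c R) (contractCP (restrictCP c S) R)
      ≈⟨ when-cong (∧-comm (p c S) (p c R)) (λ _ → contractCP-restrictCP c R⊆S) ⟩
    when (p c R ∧ p c S) (restrictCP (contractCP c R) (S ─ R))
      ≡⟨ restrictC-contractC-when c R⊆S ⟨
    restrictC (contractC (just c) R) (S ─ R) ∎
    where open ≈C-Reasoning

  contractC-restrictC-≉0 : ∀ (c : RawCP m) → R ⊆ S →
                           ¬ (contractC (restrictC (just c) S) R ≈C nothing) → T (p c S) × T (p c R)
  contractC-restrictC-≉0 c R⊆S ≉0 =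
    T-∧ .to (when-≉0⇒T (≉0 ∘ subst (_≈C nothing) (sym (contractC-restrictC-when c R⊆S))))

  restrictC-restrictC : ∀ N S R x → ElemC N x → R ⊆ S → S ⊆ N →
                        ¬ (contractC (restrictC x S) R ≈C nothing) →
                        restrictC (restrictC x S) R ≈C restrictC x R
  restrictC-restrictC N S R nothing  _ _   _ ≉0 = ⊥-elim (≉0 tt)
  restrictC-restrictC N S R (just c) _ R⊆S _ ≉0 = begin
    restrictC (restrictC (just c) S) R
      ≡⟨ restrictC²-when c R⊆S ⟩
    when (p c S ∧ p c R) (restrictCP (restrictCP c S) R)
      ≈⟨ when-cong (cong (_∧ p c R) (T-≡ .to S∈p)) (λ _ → restrictCP-restrictCP c R⊆S) ⟩
    when (p c R) (restrictCP c R)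
      ≡⟨ restrictC-just c R ⟨
    restrictC (just c) R ∎
    where
    open ≈C-Reasoning
    S∈p : T (p c S)
    S∈p = proj₁ (contractC-restrictC-≉0 c R⊆S ≉0)

  contractC-contractC : ∀ N S R x → ElemC N x → R ⊆ S → S ⊆ N →
                        ¬ (contractC (restrictC x S) R ≈C nothing) →
                        contractC x S ≈C contractC (contractC x R) (S ─ R)
  contractC-contractC N S R nothing  _ _   _ ≉0 = ⊥-elim (≉0 tt)
  contractC-contractC N S R (just c) _ R⊆S _ ≉0 = begin
    contractC (just c) S
      ≡⟨ contractC-just c S ⟩
    when (p c S) (contractCP c S)
      ≈⟨ when-cong (sym (cong (_∧ p c S) (T-≡ .to R∈p))) (λ _ → contractCP-contractCP c R⊆S) ⟩
    when (p c R ∧ p c S) (contractCP (contractCP c R) (S ─ R))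
      ≡⟨ contractC²-when c R⊆S ⟨
    contractC (contractC (just c) R) (S ─ R) ∎
    where
    open ≈C-Reasoning
    R∈p : T (p c R)
    R∈p = proj₂ (contractC-restrictC-≉0 c R⊆S ≉0)

  restrictC-full : ∀ N x → ElemC N x → restrictC x N ≈C x
  restrictC-full N nothing  _  = tt
  restrictC-full N (just c) cp = begin
    restrictC (just c) N                  ≡⟨ restrictC-just c N ⟩
    when (p c N) (restrictCP c N)         ≈⟨ when-cong (T-≡ .to (IsColoringProblem.p-full cp))
                                                       (λ _ → restrictCP-full cp) ⟩
    just c                                ∎
    where open ≈C-Reasoning

  contractC-∅ : ∀ N x → ElemC N x → contractC x ∅ ≈C x
  contractC-∅ N nothing  _  = tt
  contractC-∅ N (just c) cp = begin
    contractC (just c) ∅                  ≡⟨ contractC-just c ∅ ⟩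
    when (p c ∅) (contractCP c ∅)         ≈⟨ when-cong (T-≡ .to (IsColoringProblem.p-empty cp))
                                                       (λ _ → contractCP-∅ cp) ⟩
    just c                                ∎
    where open ≈C-Reasoning

  restrictC≈0⇒contractC≈0 : ∀ N S x → ElemC N x → S ⊆ N →
                            restrictC x S ≈C nothing → contractC x S ≈C nothing
  restrictC≈0⇒contractC≈0 N S nothing  _ _ _  = tt
  restrictC≈0⇒contractC≈0 N S (just c) _ _ ≈0 =
    subst (_≈C nothing) (sym (contractC-just c S))
          (when-≈0-cong (p c S) (restrictCP c S) (contractCP c S)
            (subst (_≈C nothing) (restrictC-just c S) ≈0))

  contractC≈0⇒restrictC≈0 : ∀ N S x → ElemC N x → S ⊆ N →
                            contractC x S ≈C nothing → restrictC x S ≈C nothing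
  contractC≈0⇒restrictC≈0 N S nothing  _ _ _  = tt
  contractC≈0⇒restrictC≈0 N S (just c) _ _ ≈0 =
    subst (_≈C nothing) (sym (restrictC-just c S))
          (when-≈0-cong (p c S) (contractCP c S) (restrictCP c S)
            (subst (_≈C nothing) (contractC-just c S) ≈0))

  contractC-restrictC-≉0-intro : ∀ N S U x → ElemC N x → S ⊆ U → U ⊆ N →
                                 ¬ (restrictC x S ≈C nothing) → ¬ (restrictC x U ≈C nothing) →
                                 ¬ (contractC (restrictC x U) S ≈C nothing)
  contractC-restrictC-≉0-intro N S U nothing  _ _   _ S≉0 _ = S≉0
  contractC-restrictC-≉0-intro N S U (just c) _ S⊆U _ S≉0 U≉0 =
    T⇒when-≉0 (∧-intro (∈p U U≉0) (∈p S S≉0)) ∘ subst (_≈C nothing) (contractC-restrictC-when c S⊆U)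
    where
    ∈p : ∀ V → ¬ (restrictC (just c) V ≈C nothing) → T (p c V)
    ∈p V ≉0 = when-≉0⇒T (≉0 ∘ subst (_≈C nothing) (sym (restrictC-just c V)))

mainTheorem6 : (m : ℕ) → IsCombinatorialComonoid (ColoringSpecies m)
mainTheorem6 m = record
  { zero-elem       = λ _ → tt
  ; relabel-elem    = relabelC-elem
  ; relabel-zero    = λ _ → tt
  ; relabel-id      = relabelC-id
  ; relabel-comp    = relabelC-∘
  ; restrict-elem   = restrictC-elem
  ; contract-elem   = contractC-elem
  ; nat-restrict    = restrictC-relabelC
  ; nat-contract    = contractC-relabelC
  ; coassoc₁        = contractC-restrictC
  ; coassoc₂        = λ N S R x x∈ R⊆S S⊆N ≉0 → restrictC-restrictC N S R x x∈ R⊆S S⊆N ≉0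
                                              , contractC-contractC N S R x x∈ R⊆S S⊆N ≉0
  ; counit-restrict = restrictC-full
  ; counit-contract = contractC-∅
  ; zero-iff₁       = restrictC≈0⇒contractC≈0
  ; zero-iff₂       = contractC≈0⇒restrictC≈0
  ; zero-restrict   = λ _ → tt
  ; zero-contract   = λ _ → tt
  ; combinatorial   = contractC-restrictC-≉0-intro
  }
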